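{- Let $n\in\mathbb{P}$ and let $w_0\in S_n$ be the longest element, $w_0(i)=n+1-i$. Then (i) $L(e)=0$; (ii) $L(s_i)=1$ for $i=1,\ldots,n-1$, where $s_i$ is the transposition $(i,i+1)$; (iii) $L(ww_0)=L(w_0w)=L(w_0)-L(w)$ for all $w\in S_n$; (iv) $w_0$ is the unique element of $S_n$ at which $L$ attains its maximum, and $L(w_0)=\lfloor n/2\rfloor\lceil n/2\rceil$.
   Context: $S_n$ is the symmetric group on $[n]=\{1,\ldots,n\}$, $e$ its identity. For $\sigma\in S_n$, the odd length is $L(\sigma)=|\{(i,j)\in[n]^2: i<j,\ \sigma(i)>\sigma(j),\ i\not\equiv j\pmod 2\}|$. -}

module Defs where

open import Data.Nat as ℕ using (ℕ; _%_)
open import Data.Fin as F using (Fin; toℕ)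
open import Data.Fin.Permutation using (Permutation′; _⟨$⟩ʳ_)
open import Data.List using (List; length; filter; cartesianProduct; allFin)
open import Data.Product using (_×_; _,_; proj₁; proj₂)
open import Relation.Binary.PropositionalEquality using (_≡_)
open import Relation.Nullary using (Dec; ¬_; _×-dec_; ¬?)

-- S_n is modelled by Permutation′ n (bijections Fin n ↔ Fin n); the position
-- i : Fin n stands for the integer toℕ i + 1 ∈ [n], and σ(i) = σ ⟨$⟩ʳ i.

-- (i , j) is an odd inversion of σ: i < j, σ(i) > σ(j), i ≢ j (mod 2).
-- (toℕ i + 1 ≢ toℕ j + 1 mod 2  iff  toℕ i ≢ toℕ j mod 2.)
OddInv : ∀ {n} → Permutation′ n → Fin n × Fin n → Set
OddInv σ (i , j) =
  (i F.< j) × ((σ ⟨$⟩ʳ j) F.< (σ ⟨$⟩ʳ i)) × ¬ (toℕ i % 2 ≡ toℕ j % 2)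

oddInv? : ∀ {n} (σ : Permutation′ n) (p : Fin n × Fin n) → Dec (OddInv σ p)
oddInv? σ (i , j) =
  (i F.<? j) ×-dec ((σ ⟨$⟩ʳ j) F.<? (σ ⟨$⟩ʳ i)) ×-dec ¬? (toℕ i % 2 ℕ.≟ toℕ j % 2)

L : ∀ {n} → Permutation′ n → ℕ
L {n} σ = length (filter (oddInv? σ) (cartesianProduct (allFin n) (allFin n)))

module Submission where

-- The odd pairs of [n] are the pairs i < j with i ≢ j (mod 2); L(w) counts the odd pairs on which
-- w descends.  Every odd pair is either an odd ascent or an odd inversion of w, so
-- (odd ascents of w) + L(w) = (number of odd pairs).  Composing w with w₀ on either side turns the
-- odd ascents of w into odd inversions: reversing values does so pair by pair, reversing positions
-- after reflecting the pair (i , j) to (n-1-j , n-1-i), which preserves oddness.  This one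
-- complementation identity gives L(e) = 0, L(w₀) = #odd pairs, part (iii) and the bound L(w) ≤ L(w₀).
-- If L(w) = L(w₀) then w w₀ has no odd inversion; since adjacent positions form odd pairs, w w₀
-- increases at every step and is therefore the identity.  The number of odd pairs is ⌊n/2⌋⌈n/2⌉ by
-- removing the first row (0 , j).  An adjacent transposition (a a+1) moves every point by at most
-- one, which pins its only inversion down to (a , a+1).

open import Defs
open import Data.Nat as ℕ using (ℕ; zero; suc; _+_; _*_; _∸_; _≤_; _<_; _/_; _%_; ⌊_/2⌋; ⌈_/2⌉; s≤s; z≤n)
import Data.Nat.Properties as ℕP
open import Data.Nat.DivMod using (%-distribˡ-+; [m+kn]%n≡m%n; m/n≡1+[m∸n]/n)
open import Data.Nat.Tactic.RingSolver using (solve-∀)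
import Data.Fin
open import Data.Fin as F using (Fin; toℕ; inject₁; opposite)
import Data.Fin.Properties as FP
open import Data.Fin.Induction using (<-weakInduction; >-weakInduction)
open import Data.Fin.Permutation using (Permutation′; id; reverse; transpose; _∘ₚ_; _⟨$⟩ʳ_; _⟨$⟩ˡ_; inverseˡ)
open import Data.Product using (_×_; _,_; proj₁; proj₂)
open import Data.Sum using (_⊎_; inj₁; inj₂)
open import Data.Empty using (⊥; ⊥-elim)
open import Data.List as List using (List; _++_; length; filter; cartesianProduct; allFin; tabulate)
import Data.List.Properties as LP
open import Function using (_∘′_)
open import Relation.Binary.PropositionalEquality
open import Relation.Binary.Definitions using (tri<; tri≈; tri>)
open import Relation.Nullary using (Dec; yes; no; ¬_; _×-dec_; ¬?)
open import Algebra.Properties.Semiring.Sum ℕP.+-*-semiring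
  using (sum; sum-cong-≗; sum-replicate-zero; ∑-distrib-+; ∑-comm; ∑-permute; *-distribˡ-sum)

𝟙 : {P : Set} → Dec P → ℕ
𝟙 (yes _) = 1
𝟙 (no _)  = 0

𝟙-yes : {P : Set} → P → (d : Dec P) → 𝟙 d ≡ 1
𝟙-yes p (yes _) = refl
𝟙-yes p (no ¬p) = ⊥-elim (¬p p)

𝟙-no : {P : Set} → ¬ P → (d : Dec P) → 𝟙 d ≡ 0
𝟙-no ¬p (yes p) = ⊥-elim (¬p p)
𝟙-no ¬p (no _)  = refl

𝟙-cong : {P Q : Set} → (P → Q) → (Q → P) → (d : Dec P) (e : Dec Q) → 𝟙 d ≡ 𝟙 e
𝟙-cong f g (yes p) e = sym (𝟙-yes (f p) e)
𝟙-cong f g (no ¬p) e = sym (𝟙-no (λ q → ¬p (g q)) e)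

𝟙-× : {P Q : Set} (d : Dec P) (e : Dec Q) → 𝟙 (d ×-dec e) ≡ 𝟙 d * 𝟙 e
𝟙-× (yes _) (yes _) = refl
𝟙-× (yes _) (no _)  = refl
𝟙-× (no _)  _       = refl

𝟙-+ : ∀ {P Q R : Set} (d : Dec P) (e : Dec Q) (f : Dec R) →
      (Q → P) → (R → P) → (Q → R → ⊥) → (P → Q ⊎ R) → 𝟙 e + 𝟙 f ≡ 𝟙 d
𝟙-+ d (yes q) (yes r) _   _   disj _ = ⊥-elim (disj q r)
𝟙-+ d (yes q) (no _)  q⇒p _   _    _ = sym (𝟙-yes (q⇒p q) d)
𝟙-+ d (no _)  (yes r) _   r⇒p _    _ = sym (𝟙-yes (r⇒p r) d)
𝟙-+ {P} d (no ¬q) (no ¬r) _   _   _    split = sym (𝟙-no neither d)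
  where
  neither : ¬ P
  neither p with split p
  ... | inj₁ q = ¬q q
  ... | inj₂ r = ¬r r

#pairs : ∀ {n} {P : Fin n × Fin n → Set} → (∀ p → Dec (P p)) → ℕ
#pairs P? = sum λ i → sum λ j → 𝟙 (P? (i , j))

length-filter-tabulate : ∀ {n} {A : Set} {P : A → Set} (P? : ∀ x → Dec (P x)) (g : Fin n → A) →
                         length (filter P? (tabulate g)) ≡ sum (λ i → 𝟙 (P? (g i)))
length-filter-tabulate {zero}  P? g = refl
length-filter-tabulate {suc n} P? g with P? (g F.zero)
... | yes _ = cong suc (length-filter-tabulate P? (g ∘′ F.suc))
... | no _  = length-filter-tabulate P? (g ∘′ F.suc)

length-filter-product : ∀ {m} {A B : Set} {P : A × B → Set} (P? : ∀ p → Dec (P p))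
                        (f : Fin m → A) (ys : List B) →
                        length (filter P? (cartesianProduct (tabulate f) ys))
                        ≡ sum (λ i → length (filter P? (List.map (f i ,_) ys)))
length-filter-product {zero}  P? f ys = refl
length-filter-product {suc m} P? f ys = begin
    length (filter P? (row ++ rest))
  ≡⟨ cong length (LP.filter-++ P? row rest) ⟩
    length (filter P? row ++ filter P? rest)
  ≡⟨ LP.length-++ (filter P? row) ⟩
    length (filter P? row) + length (filter P? rest)
  ≡⟨ cong (length (filter P? row) +_) (length-filter-product P? (f ∘′ F.suc) ys) ⟩
    _ ∎
  where
  open ≡-Reasoning
  row  = List.map (f F.zero ,_) ys
  rest = cartesianProduct (tabulate (f ∘′ F.suc)) ys

L≡#pairs : ∀ {n} (σ : Permutation′ n) → L σ ≡ #pairs (oddInv? σ)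
L≡#pairs {n} σ = begin
    length (filter (oddInv? σ) (cartesianProduct (allFin n) (allFin n)))
  ≡⟨ length-filter-product (oddInv? σ) (λ i → i) (allFin n) ⟩
    sum (λ i → length (filter (oddInv? σ) (List.map (i ,_) (allFin n))))
  ≡⟨ sum-cong-≗ (λ i → cong (length ∘′ filter (oddInv? σ)) (LP.map-tabulate (λ j → j) (i ,_))) ⟩
    sum (λ i → length (filter (oddInv? σ) (tabulate (i ,_))))
  ≡⟨ sum-cong-≗ (λ i → length-filter-tabulate (oddInv? σ) (i ,_)) ⟩
    #pairs (oddInv? σ) ∎
  where open ≡-Reasoning

sum≡0⇒ : ∀ {n} (f : Fin n → ℕ) → sum f ≡ 0 → ∀ i → f i ≡ 0
sum≡0⇒ {suc n} f s≡0 F.zero    = ℕP.m+n≡0⇒m≡0 (f F.zero) s≡0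
sum≡0⇒ {suc n} f s≡0 (F.suc i) = sum≡0⇒ (f ∘′ F.suc) (ℕP.m+n≡0⇒n≡0 (f F.zero) s≡0) i

sum-𝟙≟ : ∀ {n} (b : Fin n) → sum (λ j → 𝟙 (j F.≟ b)) ≡ 1
sum-𝟙≟ {suc n} F.zero = cong suc (begin
    sum (λ (j : Fin n) → 𝟙 (F.suc j F.≟ F.zero))
  ≡⟨ sum-cong-≗ (λ (j : Fin n) → 𝟙-no (λ ()) (F.suc j F.≟ F.zero)) ⟩
    sum (λ (_ : Fin n) → 0)
  ≡⟨ sum-replicate-zero n ⟩
    0 ∎)
  where open ≡-Reasoning
sum-𝟙≟ {suc n} (F.suc b) = begin
    sum (λ j → 𝟙 (F.suc j F.≟ F.suc b))
  ≡⟨ sum-cong-≗ (λ j → 𝟙-cong FP.suc-injective (cong F.suc) (F.suc j F.≟ F.suc b) (j F.≟ b)) ⟩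
    sum (λ j → 𝟙 (j F.≟ b))
  ≡⟨ sum-𝟙≟ b ⟩
    1 ∎
  where open ≡-Reasoning

module _ {n : ℕ} where

  #pairs-cong : ∀ {P Q : Fin n × Fin n → Set} (P? : ∀ p → Dec (P p)) (Q? : ∀ p → Dec (Q p)) →
                (∀ {p} → P p → Q p) → (∀ {p} → Q p → P p) → #pairs P? ≡ #pairs Q?
  #pairs-cong P? Q? to from =
    sum-cong-≗ λ i → sum-cong-≗ λ j → 𝟙-cong to from (P? (i , j)) (Q? (i , j))

  #pairs-split : ∀ {P Q R : Fin n × Fin n → Set}
                 (P? : ∀ p → Dec (P p)) (Q? : ∀ p → Dec (Q p)) (R? : ∀ p → Dec (R p)) →
                 (∀ {p} → Q p → P p) → (∀ {p} → R p → P p) → (∀ {p} → Q p → R p → ⊥) →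
                 (∀ {p} → P p → Q p ⊎ R p) → #pairs Q? + #pairs R? ≡ #pairs P?
  #pairs-split P? Q? R? q⇒p r⇒p disj split = begin
      #pairs Q? + #pairs R?
    ≡⟨ ∑-distrib-+ (λ i → sum (λ j → 𝟙 (Q? (i , j)))) (λ i → sum (λ j → 𝟙 (R? (i , j)))) ⟨
      sum (λ i → sum (λ j → 𝟙 (Q? (i , j))) + sum (λ j → 𝟙 (R? (i , j))))
    ≡⟨ sum-cong-≗ (λ i → ∑-distrib-+ (λ j → 𝟙 (Q? (i , j))) (λ j → 𝟙 (R? (i , j)))) ⟨
      sum (λ i → sum (λ j → 𝟙 (Q? (i , j)) + 𝟙 (R? (i , j))))
    ≡⟨ sum-cong-≗ (λ i → sum-cong-≗ λ j →
         𝟙-+ (P? (i , j)) (Q? (i , j)) (R? (i , j)) q⇒p r⇒p disj split) ⟩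
      #pairs P? ∎
    where open ≡-Reasoning

  -- Counting is invariant under the reflection (i , j) ↦ (n-1-j , n-1-i) of the square,
  -- since it is composed of the permutation i ↦ n-1-i in each coordinate and a swap.
  reflect : Fin n × Fin n → Fin n × Fin n
  reflect (i , j) = opposite j , opposite i

  #pairs-reflect : ∀ {P : Fin n × Fin n → Set} (P? : ∀ p → Dec (P p)) →
                   #pairs (λ p → P? (reflect p)) ≡ #pairs P?
  #pairs-reflect P? = begin
      sum (λ i → sum (λ j → 𝟙 (P? (opposite j , opposite i))))
    ≡⟨ ∑-comm (λ i j → 𝟙 (P? (opposite j , opposite i))) ⟩
      sum (λ j → sum (λ i → 𝟙 (P? (opposite j , opposite i))))
    ≡⟨ sum-cong-≗ (λ j → ∑-permute (λ i → 𝟙 (P? (opposite j , i))) reverse) ⟨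
      sum (λ j → sum (λ i → 𝟙 (P? (opposite j , i))))
    ≡⟨ ∑-permute (λ j → sum (λ i → 𝟙 (P? (j , i)))) reverse ⟨
      #pairs P? ∎
    where open ≡-Reasoning

  #pairs-none : ∀ {P : Fin n × Fin n → Set} (P? : ∀ p → Dec (P p)) → (∀ p → ¬ P p) → #pairs P? ≡ 0
  #pairs-none P? none = begin
      #pairs P?
    ≡⟨ sum-cong-≗ (λ i → sum-cong-≗ λ j → 𝟙-no (none (i , j)) (P? (i , j))) ⟩
      sum (λ (_ : Fin n) → sum (λ (_ : Fin n) → 0))
    ≡⟨ sum-cong-≗ (λ (_ : Fin n) → sum-replicate-zero n) ⟩
      sum (λ (_ : Fin n) → 0)
    ≡⟨ sum-replicate-zero n ⟩
      0 ∎
    where open ≡-Reasoning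

  #pairs≡0⇒ : ∀ {P : Fin n × Fin n → Set} (P? : ∀ p → Dec (P p)) → #pairs P? ≡ 0 → ∀ p → ¬ P p
  #pairs≡0⇒ P? count≡0 (i , j) pij = ℕP.0≢1+n (begin
      0
    ≡⟨ sum≡0⇒ (λ j → 𝟙 (P? (i , j))) (sum≡0⇒ _ count≡0 i) j ⟨
      𝟙 (P? (i , j))
    ≡⟨ 𝟙-yes pij (P? (i , j)) ⟩
      1 ∎)
    where open ≡-Reasoning

  #pairs-singleton : (a b : Fin n) → #pairs (λ p → (proj₁ p F.≟ a) ×-dec (proj₂ p F.≟ b)) ≡ 1
  #pairs-singleton a b = begin
      sum (λ i → sum (λ j → 𝟙 ((i F.≟ a) ×-dec (j F.≟ b))))
    ≡⟨ sum-cong-≗ (λ i → sum-cong-≗ λ j → 𝟙-× (i F.≟ a) (j F.≟ b)) ⟩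
      sum (λ i → sum (λ j → 𝟙 (i F.≟ a) * 𝟙 (j F.≟ b)))
    ≡⟨ sum-cong-≗ (λ i → *-distribˡ-sum (𝟙 (i F.≟ a)) (λ j → 𝟙 (j F.≟ b))) ⟨
      sum (λ i → 𝟙 (i F.≟ a) * sum (λ j → 𝟙 (j F.≟ b)))
    ≡⟨ sum-cong-≗ (λ i → trans (cong (𝟙 (i F.≟ a) *_) (sum-𝟙≟ b)) (ℕP.*-identityʳ _)) ⟩
      sum (λ i → 𝟙 (i F.≟ a))
    ≡⟨ sum-𝟙≟ a ⟩
      1 ∎
    where open ≡-Reasoning

_≡₂_ : ℕ → ℕ → Set
a ≡₂ b = a % 2 ≡ b % 2

+-≡₂ : ∀ {a b c d} → a ≡₂ b → c ≡₂ d → (a + c) ≡₂ (b + d)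
+-≡₂ {a} {b} {c} {d} a≡₂b c≡₂d = begin
    (a + c) % 2           ≡⟨ %-distribˡ-+ a c 2 ⟩
    (a % 2 + c % 2) % 2   ≡⟨ cong₂ (λ x y → (x + y) % 2) a≡₂b c≡₂d ⟩
    (b % 2 + d % 2) % 2   ≡⟨ %-distribˡ-+ b d 2 ⟨
    (b + d) % 2           ∎
  where open ≡-Reasoning

-- Adding c + c does not change parity, hence c + _ may be cancelled.
≡₂-cancelˡ : ∀ c {a b} → (c + a) ≡₂ (c + b) → a ≡₂ b
≡₂-cancelˡ c {a} {b} same = begin
    a % 2                  ≡⟨ shift a ⟨
    ((c + a) + c) % 2      ≡⟨ +-≡₂ {c + a} {c + b} {c} {c} same refl ⟩
    ((c + b) + c) % 2      ≡⟨ shift b ⟩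
    b % 2                  ∎
  where
  open ≡-Reasoning
  shift : ∀ x → ((c + x) + c) ≡₂ x
  shift x = trans (cong (_% 2) (rearrange c x)) ([m+kn]%n≡m%n x c 2)
    where
    rearrange : ∀ y x → (y + x) + y ≡ x + y * 2
    rearrange = solve-∀

≡₂-complement : ∀ {a b c d} → a + b ≡ c + d → a ≡₂ c → b ≡₂ d
≡₂-complement {a} {b} {c} {d} sums a≡₂c = ≡₂-cancelˡ a (begin
    (a + b) % 2   ≡⟨ cong (_% 2) sums ⟩
    (c + d) % 2   ≡⟨ +-≡₂ {c} {a} {d} {d} (sym a≡₂c) refl ⟩
    (a + d) % 2   ∎)
  where open ≡-Reasoning

≢₂-suc : ∀ a → ¬ (a ≡₂ suc a)
≢₂-suc a same = ℕP.0≢1+n (≡₂-cancelˡ a (begin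
    (a + 0) % 2   ≡⟨ cong (_% 2) (ℕP.+-identityʳ a) ⟩
    a % 2         ≡⟨ same ⟩
    suc a % 2     ≡⟨ cong (_% 2) (ℕP.+-comm 1 a) ⟩
    (a + 1) % 2   ∎))
  where open ≡-Reasoning

-- opposite i = n - 1 - i reverses the order of Fin n and preserves equality of parity,
-- the latter because i + opposite i = n - 1 does not depend on i.
toℕ-+-opposite : ∀ {m} (i : Fin (suc m)) → toℕ i + toℕ (opposite i) ≡ m
toℕ-+-opposite {m} i = begin
    toℕ i + toℕ (opposite i) ≡⟨ cong (toℕ i +_) (FP.opposite-prop i) ⟩
    toℕ i + (m ∸ toℕ i)      ≡⟨ ℕP.m+[n∸m]≡n (FP.toℕ≤pred[n] i) ⟩
    m                        ∎
  where open ≡-Reasoning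

opposite-≡₂ : ∀ {n} {i j : Fin n} → toℕ i ≡₂ toℕ j → toℕ (opposite i) ≡₂ toℕ (opposite j)
opposite-≡₂ {suc m} {i} {j} = ≡₂-complement {toℕ i} {toℕ (opposite i)} {toℕ j} {toℕ (opposite j)}
  (trans (toℕ-+-opposite i) (sym (toℕ-+-opposite j)))

opposite-≡₂⁻ : ∀ {n} {i j : Fin n} → toℕ (opposite i) ≡₂ toℕ (opposite j) → toℕ i ≡₂ toℕ j
opposite-≡₂⁻ {i = i} {j} same =
  subst₂ (λ x y → toℕ x ≡₂ toℕ y) (FP.opposite-involutive i) (FP.opposite-involutive j)
    (opposite-≡₂ {i = opposite i} {opposite j} same)

opposite-< : ∀ {n} {i j : Fin n} → i F.< j → opposite j F.< opposite i
opposite-< {suc m} {i} {j} i<j = subst₂ _<_ (sym (FP.opposite-prop j)) (sym (FP.opposite-prop i))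
  (ℕP.∸-monoʳ-< (s≤s i<j) (FP.toℕ<n j))

opposite-<⁻ : ∀ {n} {i j : Fin n} → opposite j F.< opposite i → i F.< j
opposite-<⁻ {i = i} {j} =
  subst₂ F._<_ (FP.opposite-involutive i) (FP.opposite-involutive j) ∘′ opposite-<

OddPair : ∀ {n} → Fin n × Fin n → Set
OddPair (i , j) = (i F.< j) × ¬ (toℕ i ≡₂ toℕ j)

oddPair? : ∀ {n} (p : Fin n × Fin n) → Dec (OddPair p)
oddPair? (i , j) = (i F.<? j) ×-dec ¬? (toℕ i % 2 ℕ.≟ toℕ j % 2)

#oddPairs : ℕ → ℕ
#oddPairs n = #pairs (oddPair? {n})

OddAsc : ∀ {n} → Permutation′ n → Fin n × Fin n → Set
OddAsc σ (i , j) = (i F.< j) × ((σ ⟨$⟩ʳ i) F.< (σ ⟨$⟩ʳ j)) × ¬ (toℕ i ≡₂ toℕ j)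

oddAsc? : ∀ {n} (σ : Permutation′ n) (p : Fin n × Fin n) → Dec (OddAsc σ p)
oddAsc? σ (i , j) = (i F.<? j) ×-dec ((σ ⟨$⟩ʳ i) F.<? (σ ⟨$⟩ʳ j)) ×-dec ¬? (toℕ i % 2 ℕ.≟ toℕ j % 2)

perm-injective : ∀ {n} (σ : Permutation′ n) {i j} → σ ⟨$⟩ʳ i ≡ σ ⟨$⟩ʳ j → i ≡ j
perm-injective σ {i} {j} σi≡σj = begin
    i                       ≡⟨ inverseˡ σ ⟨
    σ ⟨$⟩ˡ (σ ⟨$⟩ʳ i)       ≡⟨ cong (σ ⟨$⟩ˡ_) σi≡σj ⟩
    σ ⟨$⟩ˡ (σ ⟨$⟩ʳ j)       ≡⟨ inverseˡ σ ⟩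
    j                       ∎
  where open ≡-Reasoning

ascents+inversions : ∀ {n} (σ : Permutation′ n) → #pairs (oddAsc? σ) + L σ ≡ #oddPairs n
ascents+inversions σ = trans (cong (#pairs (oddAsc? σ) +_) (L≡#pairs σ))
  (#pairs-split oddPair? (oddAsc? σ) (oddInv? σ)
    (λ (i<j , _ , odd) → i<j , odd)
    (λ (i<j , _ , odd) → i<j , odd)
    (λ (_ , asc , _) (_ , inv , _) → FP.<-asym asc inv)
    classify)
  where
  classify : ∀ {p} → OddPair p → OddAsc σ p ⊎ OddInv σ p
  classify {i , j} (i<j , odd) with FP.<-cmp (σ ⟨$⟩ʳ i) (σ ⟨$⟩ʳ j)
  ... | tri< asc _ _ = inj₁ (i<j , asc , odd)
  ... | tri≈ _ eq _  = ⊥-elim (FP.<-irrefl (perm-injective σ eq) i<j)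
  ... | tri> _ _ inv = inj₂ (i<j , inv , odd)

L-reverse-values : ∀ {n} (σ : Permutation′ n) → L (σ ∘ₚ reverse) ≡ #pairs (oddAsc? σ)
L-reverse-values σ = trans (L≡#pairs (σ ∘ₚ reverse)) (#pairs-cong (oddInv? (σ ∘ₚ reverse)) (oddAsc? σ)
  (λ (i<j , inv , odd) → i<j , opposite-<⁻ inv , odd)
  (λ (i<j , asc , odd) → i<j , opposite-< asc , odd))

-- Reversing the positions of σ does the same, up to reflecting the pairs.
L-reverse-positions : ∀ {n} (σ : Permutation′ n) → L (reverse ∘ₚ σ) ≡ #pairs (oddAsc? σ)
L-reverse-positions σ = begin
    L (reverse ∘ₚ σ)
  ≡⟨ L≡#pairs (reverse ∘ₚ σ) ⟩
    #pairs (oddInv? (reverse ∘ₚ σ))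
  ≡⟨ #pairs-reflect (oddInv? (reverse ∘ₚ σ)) ⟨
    #pairs (λ p → oddInv? (reverse ∘ₚ σ) (reflect p))
  ≡⟨ #pairs-cong _ (oddAsc? σ) to from ⟩
    #pairs (oddAsc? σ) ∎
  where
  open ≡-Reasoning
  σ-opp² : ∀ i → σ ⟨$⟩ʳ opposite (opposite i) ≡ σ ⟨$⟩ʳ i
  σ-opp² i = cong (σ ⟨$⟩ʳ_) (FP.opposite-involutive i)
  to : ∀ {p} → OddInv (reverse ∘ₚ σ) (reflect p) → OddAsc σ p
  to {i , j} (j'<i' , inv , odd) =
    opposite-<⁻ j'<i' , subst₂ F._<_ (σ-opp² i) (σ-opp² j) inv ,
    λ same → odd (opposite-≡₂ {i = j} {i} (sym same))
  from : ∀ {p} → OddAsc σ p → OddInv (reverse ∘ₚ σ) (reflect p)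
  from {i , j} (i<j , asc , odd) =
    opposite-< i<j , subst₂ F._<_ (sym (σ-opp² i)) (sym (σ-opp² j)) asc ,
    λ same → odd (sym (opposite-≡₂⁻ {i = j} {i} same))

suc-≡₂ : ∀ {a b} → (a ≡₂ b → suc a ≡₂ suc b) × (suc a ≡₂ suc b → a ≡₂ b)
suc-≡₂ {a} {b} = +-≡₂ {1} {1} {a} {b} refl , ≡₂-cancelˡ 1 {a} {b}

#parityDiffers : ℕ → ℕ → ℕ
#parityDiffers a n = sum λ (j : Fin n) → 𝟙 (¬? (a % 2 ℕ.≟ toℕ j % 2))

#parityDiffers-suc : ∀ a n → #parityDiffers (suc a) (suc n) ≡ 𝟙 (¬? (suc a % 2 ℕ.≟ 0)) + #parityDiffers a n
#parityDiffers-suc a n = cong (𝟙 (¬? (suc a % 2 ℕ.≟ 0)) +_) (sum-cong-≗ λ (j : Fin n) →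
  𝟙-cong (λ differ same → differ (proj₁ (suc-≡₂ {a} {toℕ j}) same))
         (λ differ same → differ (proj₂ (suc-≡₂ {a} {toℕ j}) same))
         (¬? (suc a % 2 ℕ.≟ suc (toℕ j) % 2)) (¬? (a % 2 ℕ.≟ toℕ j % 2)))

#odd-below : ∀ n → #parityDiffers 0 n ≡ ⌊ n /2⌋
#even-below : ∀ n → #parityDiffers 1 n ≡ ⌈ n /2⌉
#odd-below zero     = refl
#odd-below (suc n)  = trans (#parityDiffers-suc 1 n) (#even-below n)
#even-below zero    = refl
#even-below (suc n) = trans (#parityDiffers-suc 0 n) (cong suc (#odd-below n))

oddPair-suc⇔ : ∀ {n} {i j : Fin n} →
               (OddPair (F.suc i , F.suc j) → OddPair (i , j)) × (OddPair (i , j) → OddPair (F.suc i , F.suc j))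
oddPair-suc⇔ {i = i} {j} =
  (λ (i<j , odd) → ℕP.≤-pred i<j , λ same → odd (proj₁ (suc-≡₂ {toℕ i} {toℕ j}) same)) ,
  (λ (i<j , odd) → s≤s i<j , λ same → odd (proj₂ (suc-≡₂ {toℕ i} {toℕ j}) same))

-- Splitting off the first row of [n + 1]: (0 , j + 1) is an odd pair iff j is even, which
-- happens ⌈n/2⌉ times, and (i + 1 , j + 1) is an odd pair iff (i , j) is one in [n].
#oddPairs-suc : ∀ n → #oddPairs (suc n) ≡ ⌈ n /2⌉ + #oddPairs n
#oddPairs-suc n = cong₂ _+_ (trans firstRow (#even-below n)) otherRows
  where
  firstRow : sum (λ (j : Fin (suc n)) → 𝟙 (oddPair? (F.zero , j))) ≡ #parityDiffers 1 n
  firstRow = sum-cong-≗ λ (j : Fin n) →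
    𝟙-cong (λ (_ , odd) same → odd (proj₁ (suc-≡₂ {1} {toℕ j}) same))
           (λ differ → s≤s z≤n , λ same → differ (proj₂ (suc-≡₂ {1} {toℕ j}) same))
           (oddPair? (F.zero , F.suc j)) (¬? (1 % 2 ℕ.≟ toℕ j % 2))
  otherRows : sum (λ (i : Fin n) → sum (λ j → 𝟙 (oddPair? (F.suc i , j)))) ≡ #oddPairs n
  otherRows = sum-cong-≗ λ (i : Fin n) → sum-cong-≗ λ (j : Fin n) →
    𝟙-cong (proj₁ oddPair-suc⇔) (proj₂ oddPair-suc⇔) (oddPair? (F.suc i , F.suc j)) (oddPair? (i , j))

#oddPairs-formula : ∀ n → #oddPairs n ≡ ⌊ n /2⌋ * ⌈ n /2⌉
#oddPairs-formula zero    = refl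
#oddPairs-formula (suc n) = begin
    #oddPairs (suc n)              ≡⟨ #oddPairs-suc n ⟩
    ⌈ n /2⌉ + #oddPairs n          ≡⟨ cong (⌈ n /2⌉ +_) (#oddPairs-formula n) ⟩
    ⌈ n /2⌉ + ⌊ n /2⌋ * ⌈ n /2⌉    ≡⟨⟩
    suc ⌊ n /2⌋ * ⌈ n /2⌉          ≡⟨ ℕP.*-comm (suc ⌊ n /2⌋) ⌈ n /2⌉ ⟩
    ⌊ suc n /2⌋ * ⌈ suc n /2⌉      ∎
  where open ≡-Reasoning

⌊n/2⌋≡n/2 : ∀ n → ⌊ n /2⌋ ≡ n / 2
⌊n/2⌋≡n/2 zero          = refl
⌊n/2⌋≡n/2 (suc zero)    = refl
⌊n/2⌋≡n/2 (suc (suc n)) =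
  trans (cong suc (⌊n/2⌋≡n/2 n)) (sym (m/n≡1+[m∸n]/n {suc (suc n)} {2} (s≤s (s≤s z≤n))))

adjacent-oddPair : ∀ {m} (k : Fin m) → OddPair (inject₁ k , F.suc k)
adjacent-oddPair k =
  subst (ℕ._< suc (toℕ k)) (sym (FP.toℕ-inject₁ k)) ℕP.≤-refl ,
  λ same → ≢₂-suc (toℕ k) (subst (_≡₂ suc (toℕ k)) (FP.toℕ-inject₁ k) same)

module AdjacentTransposition {n} (a b : Fin n) (b≡1+a : toℕ b ≡ suc (toℕ a)) where

  τ : Permutation′ n
  τ = transpose a b

  τ-cases : ∀ x → (x ≡ a × τ ⟨$⟩ʳ x ≡ b)
                ⊎ (x ≡ b × τ ⟨$⟩ʳ x ≡ a)
                ⊎ (toℕ (τ ⟨$⟩ʳ x) ≡ toℕ x × x ≢ a × x ≢ b)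
  τ-cases x with x F.≟ a
  ... | yes x≡a = inj₁ (x≡a , refl)
  ... | no x≢a with x F.≟ b
  ...   | yes x≡b = inj₂ (inj₁ (x≡b , refl))
  ...   | no x≢b  = inj₂ (inj₂ (refl , x≢a , x≢b))

  private
    a<b : a F.< b
    a<b = ℕP.≤-reflexive (sym b≡1+a)

    a≤b : toℕ a ≤ toℕ b
    a≤b = ℕP.<⇒≤ a<b

    ≤⇒≢1+ : ∀ {x y} → x ≤ y → x ≢ suc y
    ≤⇒≢1+ x≤y = ℕP.<⇒≢ (s≤s x≤y)

  τ-a : τ ⟨$⟩ʳ a ≡ b
  τ-a with τ-cases a
  ... | inj₁ (_ , τa≡b)              = τa≡b
  ... | inj₂ (inj₁ (a≡b , _))        = ⊥-elim (FP.<-irrefl a≡b a<b)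
  ... | inj₂ (inj₂ (_ , a≢a , _))    = ⊥-elim (a≢a refl)

  τ-b : τ ⟨$⟩ʳ b ≡ a
  τ-b with τ-cases b
  ... | inj₁ (b≡a , _)               = ⊥-elim (FP.<-irrefl (sym b≡a) a<b)
  ... | inj₂ (inj₁ (_ , τb≡a))       = τb≡a
  ... | inj₂ (inj₂ (_ , _ , b≢b))    = ⊥-elim (b≢b refl)

  up-bound : ∀ x → toℕ (τ ⟨$⟩ʳ x) ≤ suc (toℕ x)
  up-bound x with τ-cases x
  ... | inj₁ (refl , τx≡b)           = ℕP.≤-reflexive (trans (cong toℕ τx≡b) b≡1+a)
  ... | inj₂ (inj₁ (refl , τx≡a))    = subst (_≤ suc (toℕ b)) (cong toℕ (sym τx≡a)) (ℕP.m≤n⇒m≤1+n a≤b)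
  ... | inj₂ (inj₂ (τx≡x , _ , _))   = ℕP.m≤n⇒m≤1+n (ℕP.≤-reflexive τx≡x)

  up-tight : ∀ x → toℕ (τ ⟨$⟩ʳ x) ≡ suc (toℕ x) → x ≡ a
  up-tight x up with τ-cases x
  ... | inj₁ (x≡a , _)               = x≡a
  ... | inj₂ (inj₁ (refl , τx≡a))    = ⊥-elim (≤⇒≢1+ a≤b (trans (cong toℕ (sym τx≡a)) up))
  ... | inj₂ (inj₂ (τx≡x , _ , _))   = ⊥-elim (≤⇒≢1+ ℕP.≤-refl (trans (sym τx≡x) up))

  down-bound : ∀ x → toℕ x ≤ suc (toℕ (τ ⟨$⟩ʳ x))
  down-bound x with τ-cases x
  ... | inj₁ (refl , τx≡b)           = ℕP.m≤n⇒m≤1+n (subst (toℕ x ≤_) (cong toℕ (sym τx≡b)) a≤b)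
  ... | inj₂ (inj₁ (refl , τx≡a))    = ℕP.≤-reflexive (trans b≡1+a (cong (suc ∘′ toℕ) (sym τx≡a)))
  ... | inj₂ (inj₂ (τx≡x , _ , _))   = ℕP.m≤n⇒m≤1+n (ℕP.≤-reflexive (sym τx≡x))

  down-tight : ∀ x → toℕ x ≡ suc (toℕ (τ ⟨$⟩ʳ x)) → x ≡ b
  down-tight x down with τ-cases x
  ... | inj₁ (refl , τx≡b)           = ⊥-elim (≤⇒≢1+ a≤b (trans down (cong (suc ∘′ toℕ) τx≡b)))
  ... | inj₂ (inj₁ (x≡b , _))        = x≡b
  ... | inj₂ (inj₂ (τx≡x , _ , _))   = ⊥-elim (≤⇒≢1+ ℕP.≤-refl (trans down (cong suc τx≡x)))

  -- An inversion i < j, τ j < τ i forces i + 1 ≤ j ≤ τ j + 1 ≤ τ i ≤ i + 1, so all are tight.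
  inversion-τ : ∀ {i j} → i F.< j → τ ⟨$⟩ʳ j F.< τ ⟨$⟩ʳ i → i ≡ a × j ≡ b
  inversion-τ {i} {j} i<j inv =
    up-tight i (ℕP.≤-antisym (up-bound i) (ℕP.≤-trans i<j (ℕP.≤-trans (down-bound j) inv))) ,
    down-tight j (ℕP.≤-antisym (down-bound j) (ℕP.≤-trans inv (ℕP.≤-trans (up-bound i) i<j)))

  L-τ : L τ ≡ 1
  L-τ = begin
      L τ
    ≡⟨ L≡#pairs τ ⟩
      #pairs (oddInv? τ)
    ≡⟨ #pairs-cong (oddInv? τ) (λ p → (proj₁ p F.≟ a) ×-dec (proj₂ p F.≟ b))
         (λ (i<j , inv , _) → inversion-τ i<j inv) (λ { (refl , refl) → ab-inversion }) ⟩
      #pairs (λ p → (proj₁ p F.≟ a) ×-dec (proj₂ p F.≟ b))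
    ≡⟨ #pairs-singleton a b ⟩
      1 ∎
    where
    open ≡-Reasoning
    ab-inversion : OddInv τ (a , b)
    ab-inversion = a<b , subst₂ F._<_ (sym τ-b) (sym τ-a) a<b ,
                   λ same → ≢₂-suc (toℕ a) (trans same (cong (ℕ._% 2) b≡1+a))

-- A self-map of Fin (m + 1) that increases at every step k ↦ k + 1 is the identity:
-- by induction upwards v i ≥ i, and by induction downwards v i ≤ i.
adjacent-increasing⇒id : ∀ {m} (v : Fin (suc m) → Fin (suc m)) →
                         (∀ k → v (inject₁ k) F.< v (F.suc k)) → ∀ i → v i ≡ i
adjacent-increasing⇒id {m} v increasing i = FP.toℕ-injective (ℕP.≤-antisym (below i) (above i))
  where
  above : ∀ i → toℕ i ≤ toℕ (v i)
  above = <-weakInduction (λ i → toℕ i ≤ toℕ (v i)) z≤n λ k ih →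
    ℕP.≤-<-trans (subst (_≤ toℕ (v (inject₁ k))) (FP.toℕ-inject₁ k) ih) (increasing k)
  below : ∀ i → toℕ (v i) ≤ toℕ i
  below = >-weakInduction (λ i → toℕ (v i) ≤ toℕ i)
    (subst (toℕ (v (F.fromℕ m)) ≤_) (sym (FP.toℕ-fromℕ m)) (FP.toℕ≤pred[n] (v (F.fromℕ m))))
    λ k ih → subst (toℕ (v (inject₁ k)) ≤_) (sym (FP.toℕ-inject₁ k))
               (ℕP.≤-pred (ℕP.<-≤-trans (increasing k) ih))

-- A permutation with no odd inversion increases at every adjacent step, hence is the identity.
no-oddInv⇒id : ∀ {m} (σ : Permutation′ (suc m)) → (∀ p → ¬ OddInv σ p) → ∀ i → σ ⟨$⟩ʳ i ≡ i
no-oddInv⇒id σ noInv = adjacent-increasing⇒id (σ ⟨$⟩ʳ_) increasing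
  where
  increasing : ∀ k → σ ⟨$⟩ʳ inject₁ k F.< σ ⟨$⟩ʳ F.suc k
  increasing k with FP.<-cmp (σ ⟨$⟩ʳ inject₁ k) (σ ⟨$⟩ʳ F.suc k) | adjacent-oddPair k
  ... | tri< asc _ _ | _          = asc
  ... | tri≈ _ eq _  | (k<k+1 , _) = ⊥-elim (FP.<-irrefl (perm-injective σ eq) k<k+1)
  ... | tri> _ _ inv | (k<k+1 , odd) = ⊥-elim (noInv _ (k<k+1 , inv , odd))

L-complement-values : ∀ {n} (w : Permutation′ n) → L (w ∘ₚ reverse) + L w ≡ #oddPairs n
L-complement-values w = trans (cong (_+ L w) (L-reverse-values w)) (ascents+inversions w)

L-complement-positions : ∀ {n} (w : Permutation′ n) → L (reverse ∘ₚ w) + L w ≡ #oddPairs n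
L-complement-positions w = trans (cong (_+ L w) (L-reverse-positions w)) (ascents+inversions w)

L-id : ∀ {n} → L (id {n}) ≡ 0
L-id {n} = trans (L≡#pairs (id {n}))
  (#pairs-none (oddInv? (id {n})) λ _ (i<j , j<i , _) → FP.<-asym i<j j<i)

-- Every odd pair is an inversion of w₀ (note that id ∘ₚ reverse is reverse by definition).
L-reverse : ∀ {n} → L (reverse {n}) ≡ #oddPairs n
L-reverse {n} = begin
    L (reverse {n})                      ≡⟨ ℕP.+-identityʳ (L (reverse {n})) ⟨
    L (reverse {n}) + 0                  ≡⟨ cong (L (reverse {n}) +_) (L-id {n}) ⟨
    L (id {n} ∘ₚ reverse) + L (id {n})   ≡⟨ L-complement-values (id {n}) ⟩
    #oddPairs n                          ∎
  where open ≡-Reasoning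

L-adjacent-transposition : ∀ {m} (k : Fin m) → L (transpose {suc m} (inject₁ k) (F.suc k)) ≡ 1
L-adjacent-transposition k =
  AdjacentTransposition.L-τ (inject₁ k) (F.suc k) (cong suc (sym (FP.toℕ-inject₁ k)))

+≡⇒≡∸ : ∀ {x y z} → x + y ≡ z → x ≡ z ∸ y
+≡⇒≡∸ {x} {y} x+y≡z = trans (sym (ℕP.m+n∸n≡m x y)) (cong (_∸ y) x+y≡z)

L-reverse-positions-∸ : ∀ {n} (w : Permutation′ n) → L (reverse ∘ₚ w) ≡ L (reverse {n}) ∸ L w
L-reverse-positions-∸ {n} w = +≡⇒≡∸ (trans (L-complement-positions w) (sym (L-reverse {n})))

L-reverse-values-∸ : ∀ {n} (w : Permutation′ n) → L (w ∘ₚ reverse) ≡ L (reverse {n}) ∸ L w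
L-reverse-values-∸ {n} w = +≡⇒≡∸ (trans (L-complement-values w) (sym (L-reverse {n})))

L≤L-reverse : ∀ {n} (w : Permutation′ n) → L w ≤ L (reverse {n})
L≤L-reverse {n} w =
  subst (L w ≤_) (trans (L-complement-values w) (sym (L-reverse {n}))) (ℕP.m≤n+m (L w) _)

L-max⇒reverse : ∀ {m} (w : Permutation′ (suc m)) → L w ≡ L (reverse {suc m}) →
                ∀ i → w ⟨$⟩ʳ i ≡ reverse {suc m} ⟨$⟩ʳ i
L-max⇒reverse {m} w Lw≡max i =
  trans (sym (FP.opposite-involutive (w ⟨$⟩ʳ i))) (cong opposite (no-oddInv⇒id v noInv i))
  where
  v : Permutation′ (suc m)
  v = w ∘ₚ reverse
  Lv≡0 : L v ≡ 0
  Lv≡0 = ℕP.+-cancelʳ-≡ (L w) (L v) 0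
    (trans (L-complement-values w) (trans (sym (L-reverse {suc m})) (sym Lw≡max)))
  noInv : ∀ p → ¬ OddInv v p
  noInv = #pairs≡0⇒ (oddInv? v) (trans (sym (L≡#pairs v)) Lv≡0)

L-reverse-value : ∀ n → L (reverse {n}) ≡ (n / 2) * ((n + 1) / 2)
L-reverse-value n = begin
    L (reverse {n})           ≡⟨ L-reverse {n} ⟩
    #oddPairs n               ≡⟨ #oddPairs-formula n ⟩
    ⌊ n /2⌋ * ⌊ suc n /2⌋     ≡⟨ cong₂ _*_ (⌊n/2⌋≡n/2 n) (⌊n/2⌋≡n/2 (suc n)) ⟩
    (n / 2) * (suc n / 2)     ≡⟨ cong (λ x → (n / 2) * (x / 2)) (ℕP.+-comm 1 n) ⟩
    (n / 2) * ((n + 1) / 2)   ∎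
  where open ≡-Reasoning

proposition2p3 : (m : ℕ) →
    (L (id {suc m}) ≡ 0)
    × ((k : Fin m) → L (transpose {suc m} (inject₁ k) (Data.Fin.suc k)) ≡ 1)
    × ((w : Permutation′ (suc m)) →
         (L (reverse ∘ₚ w) ≡ L (reverse {suc m}) ∸ L w)
         × (L (w ∘ₚ reverse) ≡ L (reverse {suc m}) ∸ L w))
    × ((w : Permutation′ (suc m)) → L w ≤ L (reverse {suc m}))
    × ((w : Permutation′ (suc m)) → L w ≡ L (reverse {suc m}) →
         (i : Fin (suc m)) → w ⟨$⟩ʳ i ≡ reverse {suc m} ⟨$⟩ʳ i)
    × (L (reverse {suc m}) ≡ (suc m / 2) * ((suc m + 1) / 2))
proposition2p3 m =
  L-id {suc m} ,
  L-adjacent-transposition ,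
  (λ w → L-reverse-positions-∸ w , L-reverse-values-∸ w) ,
  L≤L-reverse ,
  L-max⇒reverse ,
  L-reverse-value (suc m)
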